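{- Let $n_1,n_2,n_3\ge 1$ be integers. Then $\mathcal{D}(n_1,n_2,n_3)$ has an odd dijoin if and only if one of the following holds: (i) $n_2=1$; (ii) $n_2=2$ and $n_1\equiv n_3\pmod 2$; (iii) $n_2\ge 3$ and $n_1\equiv n_3\equiv 1\pmod 2$.
   Context: $\mathcal{D}(n_1,n_2,n_3)$ is the digraph with vertex set $V_1\,\dot\cup\,V_2\,\dot\cup\,V_3$, $|V_i|=n_i$, and edge set $(V_1\times V_2)\,\dot\cup\,(V_2\times V_3)$. A bond of a digraph is an inclusion-minimal nonempty edge cut $D[X,Y]$; it is directed if all its edges go from $X$ to $Y$. An odd dijoin is a set $J$ of edges with $|J\cap S|$ odd for every directed bond $S$. -}

module Defs where

open import Data.Nat using (ℕ; _%_)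
open import Data.Bool using (Bool; true; false; _xor_; _∧_)
open import Data.Fin using (Fin)
open import Data.List using (List; length; concatMap; map; allFin; filterᵇ; _++_)
open import Data.Product using (Σ; ∃; _×_; _,_)
open import Relation.Binary.PropositionalEquality using (_≡_)

data Vertex (n₁ n₂ n₃ : ℕ) : Set where
  v₁ : Fin n₁ → Vertex n₁ n₂ n₃
  v₂ : Fin n₂ → Vertex n₁ n₂ n₃
  v₃ : Fin n₃ → Vertex n₁ n₂ n₃

data Edge (n₁ n₂ n₃ : ℕ) : Set where
  e₁₂ : Fin n₁ → Fin n₂ → Edge n₁ n₂ n₃
  e₂₃ : Fin n₂ → Fin n₃ → Edge n₁ n₂ n₃

module _ {n₁ n₂ n₃ : ℕ} where

  tail : Edge n₁ n₂ n₃ → Vertex n₁ n₂ n₃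
  tail (e₁₂ i j) = v₁ i
  tail (e₂₃ j k) = v₂ j

  head : Edge n₁ n₂ n₃ → Vertex n₁ n₂ n₃
  head (e₁₂ i j) = v₂ j
  head (e₂₃ j k) = v₃ k

  allEdges : List (Edge n₁ n₂ n₃)
  allEdges = concatMap (λ i → map (e₁₂ i) (allFin n₂)) (allFin n₁)
          ++ concatMap (λ j → map (e₂₃ j) (allFin n₃)) (allFin n₂)

  EdgeSet : Set
  EdgeSet = Edge n₁ n₂ n₃ → Bool

  VertexSet : Set
  VertexSet = Vertex n₁ n₂ n₃ → Bool

  _⊆_ : EdgeSet → EdgeSet → Set
  S ⊆ T = ∀ e → S e ≡ true → T e ≡ true

  NonEmpty : EdgeSet → Set
  NonEmpty S = ∃ λ e → S e ≡ true

  _∩_ : EdgeSet → EdgeSet → EdgeSet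
  (S ∩ T) e = S e ∧ T e

  ∣_∣ : EdgeSet → ℕ
  ∣ S ∣ = length (filterᵇ S allEdges)

  cut : VertexSet → EdgeSet
  cut X e = X (tail e) xor X (head e)

  IsCut : EdgeSet → Set
  IsCut S = ∃ λ X → ∀ e → S e ≡ cut X e

  IsBond : EdgeSet → Set
  IsBond S = IsCut S × NonEmpty S
           × (∀ T → IsCut T → NonEmpty T → T ⊆ S → S ⊆ T)

  IsDirectedBond : EdgeSet → Set
  IsDirectedBond S = IsBond S
    × ∃ λ X → (∀ e → S e ≡ cut X e) × (∀ e → S e ≡ true → X (tail e) ≡ true)

  IsOddDijoin : EdgeSet → Set
  IsOddDijoin J = ∀ S → IsDirectedBond S → ∣ J ∩ S ∣ % 2 ≡ 1

HasOddDijoin : ℕ → ℕ → ℕ → Set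
HasOddDijoin n₁ n₂ n₃ = ∃ λ (J : EdgeSet {n₁} {n₂} {n₃}) → IsOddDijoin J

-- Counting modulo 2, |J ∩ D[X,Y]| ≡ Σ_{v ∈ X} deg_J v, since an edge with both ends in X is counted
-- twice. The directed bonds of 𝒟(n₁,n₂,n₃) are exactly the cuts whose tail shore is {a} (a ∈ V₁),
-- V ∖ {c} (c ∈ V₃), or V₁ ∪ B with ∅ ≠ B ⊊ V₂. Hence J is an odd dijoin iff deg_J is odd on V₁ and
-- on V₃, and n₁ + Σ_{b ∈ B} deg_J b is odd for every such B.
-- When n₂ ≥ 2 the singletons B = {b} force deg_J b ≡ n₁ + 1 on all of V₂, and the handshake lemma
-- n₁ + Σ_{V₂} deg_J + n₃ ≡ 0 then gives n₁ ≡ n₃ for n₂ = 2; for n₂ ≥ 3 a two-element B forces n₁ odd.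
-- Conversely the star of all edges at one middle vertex is an odd dijoin when n₂ = 1 or n₁, n₃ are
-- odd; for n₂ = 2 and n₁, n₃ even, one of its edges is moved to the other middle vertex.

module Submission where

open import Defs
open import Data.Nat using (ℕ; _≤_; _%_)
open import Data.Product using (_×_)
open import Data.Sum using (_⊎_)
open import Function.Bundles using (_⇔_)
open import Relation.Binary.PropositionalEquality using (_≡_)

open import Algebra.Bundles using (CommutativeRing)
open import Data.Bool using (Bool; true; false; not; _xor_; _∧_; if_then_else_)
open import Data.Bool.Properties
  using ( xor-∧-commutativeRing; xor-assoc; xor-comm; xor-identityʳ; xor-same; true-xor
        ; not-involutive; not-injective; ¬-not
        ; ∧-comm; ∧-identityʳ; ∧-zeroʳ; ∧-distribˡ-xor; ∧-distribʳ-xor )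
import Data.Bool.Properties as Bool
open import Data.Fin using (Fin; zero; suc; punchIn)
open import Data.Fin.Properties using (_≟_; punchInᵢ≢i; any?)
open import Data.List
  using (List; []; _∷_; length; map; concatMap; allFin; filterᵇ; tabulate; _++_; foldr)
open import Data.List.Properties using (map-++; map-cong; map-∘; map-concatMap; map-tabulate)
open import Data.Nat using (zero; suc; s≤s; z≤n)
open import Data.Product using (_,_; ∃)
open import Data.Sum using (inj₁; inj₂)
open import Function using (_∘_; id)
open import Function.Bundles using (mk⇔)
open import Relation.Binary.PropositionalEquality
  using (refl; sym; trans; cong; cong₂; _≗_; module ≡-Reasoning)
open import Relation.Nullary using (contradiction)
open import Relation.Nullary.Decidable using (does; dec-true; dec-false; yes; no)

open import Algebra.Properties.Semiring.Sum (CommutativeRing.semiring xor-∧-commutativeRing)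
  using (sum-syntax; sum-cong-≗; sum-replicate-zero; ∑-distrib-+; ∑-comm; *-distribˡ-sum)

open ≡-Reasoning

-- Sums over Fin n are taken in the field 𝔽₂ = (Bool, xor, ∧).

isOdd : ℕ → Bool
isOdd zero = false
isOdd (suc n) = not (isOdd n)

%2≡if-isOdd : ∀ n → n % 2 ≡ (if isOdd n then 1 else 0)
%2≡if-isOdd zero = refl
%2≡if-isOdd (suc zero) = refl
%2≡if-isOdd (suc (suc n)) rewrite not-involutive (isOdd n) = %2≡if-isOdd n

if-1-0-injective : ∀ {a b} → (if a then 1 else 0) ≡ (if b then 1 else 0) → a ≡ b
if-1-0-injective {true} {true} _ = refl
if-1-0-injective {false} {false} _ = refl

%2≡⇒isOdd≡ : ∀ m n → m % 2 ≡ n % 2 → isOdd m ≡ isOdd n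
%2≡⇒isOdd≡ m n m≡n = if-1-0-injective (trans (sym (%2≡if-isOdd m)) (trans m≡n (%2≡if-isOdd n)))

isOdd≡⇒%2≡ : ∀ m n → isOdd m ≡ isOdd n → m % 2 ≡ n % 2
isOdd≡⇒%2≡ m n m≡n = trans (%2≡if-isOdd m) (trans (cong (if_then 1 else 0) m≡n) (sym (%2≡if-isOdd n)))

%2≡1⇒isOdd : ∀ n → n % 2 ≡ 1 → isOdd n ≡ true
%2≡1⇒isOdd n = %2≡⇒isOdd≡ n 1

isOdd⇒%2≡1 : ∀ n → isOdd n ≡ true → n % 2 ≡ 1
isOdd⇒%2≡1 n = isOdd≡⇒%2≡ n 1

xor≡false⇒≡ : ∀ {a b} → a xor b ≡ false → a ≡ b
xor≡false⇒≡ {true} {true} _ = refl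
xor≡false⇒≡ {false} {false} _ = refl

xor≡true⇒map-xor : ∀ {a b} (f : Bool → Bool) → a xor b ≡ true → f a xor f b ≡ f true xor f false
xor≡true⇒map-xor {true} {false} f _ = refl
xor≡true⇒map-xor {false} {true} f _ = xor-comm (f false) (f true)

xor≡true⇒≡not : ∀ {a b} → a xor b ≡ true → b ≡ not a
xor≡true⇒≡not {true} {false} _ = refl
xor≡true⇒≡not {false} {true} _ = refl

∑-false : ∀ n → ∑[ i < n ] false ≡ false
∑-false n = sum-replicate-zero n

∑-const : ∀ n c → ∑[ i < n ] c ≡ isOdd n ∧ c
∑-const zero c = refl
∑-const (suc n) c = trans (cong (c xor_) (∑-const n c)) (step (isOdd n))
  where
  step : ∀ p → c xor (p ∧ c) ≡ not p ∧ c
  step true = xor-same c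
  step false = xor-identityʳ c

∑-true : ∀ n → ∑[ i < n ] true ≡ isOdd n
∑-true n = trans (∑-const n true) (∧-identityʳ (isOdd n))

∑-all-true : ∀ {n} {f : Fin n → Bool} → (∀ i → f i ≡ true) → ∑[ i < n ] f i ≡ isOdd n
∑-all-true {n} f≡true = trans (sum-cong-≗ f≡true) (∑-true n)

_==_ : ∀ {n} → Fin n → Fin n → Bool
i == j = does (i ≟ j)

==-refl : ∀ {n} (i : Fin n) → (i == i) ≡ true
==-refl i = dec-true (i ≟ i) refl

==⇒≡ : ∀ {n} {i j : Fin n} → (i == j) ≡ true → i ≡ j
==⇒≡ {i = i} {j} i==j with i ≟ j
... | yes i≡j = i≡j
... | no _ = contradiction i==j λ ()

∑-indicator : ∀ {n} (i : Fin n) (f : Fin n → Bool) → ∑[ k < n ] ((k == i) ∧ f k) ≡ f i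
∑-indicator {suc n} zero f = trans (cong (f zero xor_) (∑-false n)) (xor-identityʳ (f zero))
∑-indicator {suc n} (suc i) f = ∑-indicator i (f ∘ suc)

∑-singleton : ∀ {n} (i : Fin n) → ∑[ k < n ] (k == i) ≡ true
∑-singleton i = trans (sum-cong-≗ (λ k → sym (∧-identityʳ (k == i)))) (∑-indicator i (λ _ → true))

∑-not∧ : ∀ {n} (y f : Fin n → Bool) →
  ∑[ i < n ] (not (y i) ∧ f i) ≡ ∑[ i < n ] f i xor ∑[ i < n ] (y i ∧ f i)
∑-not∧ {n} y f = trans (sum-cong-≗ pointwise) (∑-distrib-+ f (λ i → y i ∧ f i))
  where
  pointwise : ∀ i → not (y i) ∧ f i ≡ f i xor (y i ∧ f i)
  pointwise i = begin
    not (y i) ∧ f i            ≡⟨ cong (_∧ f i) (sym (true-xor (y i))) ⟩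
    (true xor y i) ∧ f i       ≡⟨ ∧-distribʳ-xor (f i) true (y i) ⟩
    f i xor (y i ∧ f i)        ∎

∑∑-∧-xor : ∀ {m n} (J : Fin m → Fin n → Bool) (a : Fin m → Bool) (b : Fin n → Bool) →
  ∑[ i < m ] ∑[ j < n ] (J i j ∧ (a i xor b j))
    ≡ ∑[ i < m ] (a i ∧ ∑[ j < n ] J i j) xor ∑[ j < n ] (b j ∧ ∑[ i < m ] J i j)
∑∑-∧-xor {m} {n} J a b = begin
  ∑[ i < m ] ∑[ j < n ] (J i j ∧ (a i xor b j))
    ≡⟨ sum-cong-≗ (λ i → trans (sum-cong-≗ (split i)) (∑-distrib-+ (λ j → a i ∧ J i j) _)) ⟩
  ∑[ i < m ] (∑[ j < n ] (a i ∧ J i j) xor ∑[ j < n ] (b j ∧ J i j))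
    ≡⟨ ∑-distrib-+ (λ i → ∑[ j < n ] (a i ∧ J i j)) (λ i → ∑[ j < n ] (b j ∧ J i j)) ⟩
  ∑[ i < m ] ∑[ j < n ] (a i ∧ J i j) xor ∑[ i < m ] ∑[ j < n ] (b j ∧ J i j)
    ≡⟨ cong₂ _xor_ (sum-cong-≗ (λ i → sym (*-distribˡ-sum (a i) (J i))))
                   (∑-comm (λ i j → b j ∧ J i j)) ⟩
  ∑[ i < m ] (a i ∧ ∑[ j < n ] J i j) xor ∑[ j < n ] ∑[ i < m ] (b j ∧ J i j)
    ≡⟨ cong (∑[ i < m ] (a i ∧ ∑[ j < n ] J i j) xor_)
            (sum-cong-≗ (λ j → sym (*-distribˡ-sum (b j) (λ i → J i j)))) ⟩
  ∑[ i < m ] (a i ∧ ∑[ j < n ] J i j) xor ∑[ j < n ] (b j ∧ ∑[ i < m ] J i j) ∎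
  where
  split : ∀ i j → J i j ∧ (a i xor b j) ≡ (a i ∧ J i j) xor (b j ∧ J i j)
  split i j = trans (∧-comm (J i j) _) (∧-distribʳ-xor (J i j) (a i) (b j))

⊕ˡ : List Bool → Bool
⊕ˡ = foldr _xor_ false

⊕ˡ-++ : ∀ xs ys → ⊕ˡ (xs ++ ys) ≡ ⊕ˡ xs xor ⊕ˡ ys
⊕ˡ-++ [] ys = refl
⊕ˡ-++ (x ∷ xs) ys = trans (cong (x xor_) (⊕ˡ-++ xs ys)) (sym (xor-assoc x (⊕ˡ xs) (⊕ˡ ys)))

⊕ˡ-concatMap : ∀ {A : Set} (g : A → List Bool) xs → ⊕ˡ (concatMap g xs) ≡ ⊕ˡ (map (⊕ˡ ∘ g) xs)
⊕ˡ-concatMap g [] = refl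
⊕ˡ-concatMap g (x ∷ xs) = trans (⊕ˡ-++ (g x) (concatMap g xs)) (cong (⊕ˡ (g x) xor_) (⊕ˡ-concatMap g xs))

⊕ˡ-tabulate : ∀ {n} (f : Fin n → Bool) → ⊕ˡ (tabulate f) ≡ ∑[ i < n ] f i
⊕ˡ-tabulate {zero} f = refl
⊕ˡ-tabulate {suc n} f = cong (f zero xor_) (⊕ˡ-tabulate (f ∘ suc))

⊕ˡ-map-allFin : ∀ {n} (f : Fin n → Bool) → ⊕ˡ (map f (allFin n)) ≡ ∑[ i < n ] f i
⊕ˡ-map-allFin f = trans (cong ⊕ˡ (map-tabulate id f)) (⊕ˡ-tabulate f)

isOdd-count : ∀ {A : Set} (P : A → Bool) xs → isOdd (length (filterᵇ P xs)) ≡ ⊕ˡ (map P xs)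
isOdd-count P [] = refl
isOdd-count P (x ∷ xs) with P x
... | true = cong not (isOdd-count P xs)
... | false = isOdd-count P xs

⊕ˡ-map-grid : ∀ {A : Set} {m n} (P : A → Bool) (e : Fin m → Fin n → A) →
  ⊕ˡ (map P (concatMap (λ i → map (e i) (allFin n)) (allFin m))) ≡ ∑[ i < m ] ∑[ j < n ] P (e i j)
⊕ˡ-map-grid {A} {m} {n} P e = begin
  ⊕ˡ (map P (concatMap row (allFin m)))            ≡⟨ cong ⊕ˡ (map-concatMap P row (allFin m)) ⟩
  ⊕ˡ (concatMap (map P ∘ row) (allFin m))          ≡⟨ ⊕ˡ-concatMap (map P ∘ row) (allFin m) ⟩
  ⊕ˡ (map (⊕ˡ ∘ map P ∘ row) (allFin m))           ≡⟨ ⊕ˡ-map-allFin (λ i → ⊕ˡ (map P (row i))) ⟩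
  ∑[ i < m ] ⊕ˡ (map P (row i))
    ≡⟨ sum-cong-≗ (λ i → cong ⊕ˡ (map-∘ {g = P} {f = e i} (allFin n))) ⟨
  ∑[ i < m ] ⊕ˡ (map (P ∘ e i) (allFin n))         ≡⟨ sum-cong-≗ (λ i → ⊕ˡ-map-allFin (P ∘ e i)) ⟩
  ∑[ i < m ] ∑[ j < n ] P (e i j)                  ∎
  where
  row : Fin m → List A
  row i = map (e i) (allFin n)

module _ {n₁ n₂ n₃ : ℕ} where

  ∑ᵛ : (Vertex n₁ n₂ n₃ → Bool) → Bool
  ∑ᵛ f = ∑[ i < n₁ ] f (v₁ i) xor (∑[ j < n₂ ] f (v₂ j) xor ∑[ k < n₃ ] f (v₃ k))

  ∑ᵛ-cong : ∀ {f g : Vertex n₁ n₂ n₃ → Bool} → f ≗ g → ∑ᵛ f ≡ ∑ᵛ g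
  ∑ᵛ-cong f≗g = cong₂ _xor_ (sum-cong-≗ (f≗g ∘ v₁))
                  (cong₂ _xor_ (sum-cong-≗ (f≗g ∘ v₂)) (sum-cong-≗ (f≗g ∘ v₃)))

  ∑ᵛ-cong-shore : ∀ {X Y : VertexSet} (f : Vertex n₁ n₂ n₃ → Bool) → X ≗ Y →
    ∑ᵛ (λ v → X v ∧ f v) ≡ ∑ᵛ (λ v → Y v ∧ f v)
  ∑ᵛ-cong-shore f X≗Y = ∑ᵛ-cong (λ v → cong (_∧ f v) (X≗Y v))

  deg : EdgeSet {n₁} {n₂} {n₃} → Vertex n₁ n₂ n₃ → Bool
  deg J (v₁ i) = ∑[ j < n₂ ] J (e₁₂ i j)
  deg J (v₂ j) = ∑[ i < n₁ ] J (e₁₂ i j) xor ∑[ k < n₃ ] J (e₂₃ j k)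
  deg J (v₃ k) = ∑[ j < n₂ ] J (e₂₃ j k)

  isOdd-∣∣ : (S : EdgeSet {n₁} {n₂} {n₃}) →
    isOdd ∣ S ∣ ≡ ∑[ i < n₁ ] ∑[ j < n₂ ] S (e₁₂ i j) xor ∑[ j < n₂ ] ∑[ k < n₃ ] S (e₂₃ j k)
  isOdd-∣∣ S = begin
    isOdd ∣ S ∣                       ≡⟨ isOdd-count S (L₁₂ ++ L₂₃) ⟩
    ⊕ˡ (map S (L₁₂ ++ L₂₃))           ≡⟨ cong ⊕ˡ (map-++ S L₁₂ L₂₃) ⟩
    ⊕ˡ (map S L₁₂ ++ map S L₂₃)       ≡⟨ ⊕ˡ-++ (map S L₁₂) (map S L₂₃) ⟩
    ⊕ˡ (map S L₁₂) xor ⊕ˡ (map S L₂₃)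
      ≡⟨ cong₂ _xor_ (⊕ˡ-map-grid S e₁₂) (⊕ˡ-map-grid S e₂₃) ⟩
    ∑[ i < n₁ ] ∑[ j < n₂ ] S (e₁₂ i j) xor ∑[ j < n₂ ] ∑[ k < n₃ ] S (e₂₃ j k) ∎
    where
    L₁₂ L₂₃ : List (Edge n₁ n₂ n₃)
    L₁₂ = concatMap (λ i → map (e₁₂ i) (allFin n₂)) (allFin n₁)
    L₂₃ = concatMap (λ j → map (e₂₃ j) (allFin n₃)) (allFin n₂)

  isOdd-∣∣-cong : ∀ {S T : EdgeSet {n₁} {n₂} {n₃}} → S ≗ T → isOdd ∣ S ∣ ≡ isOdd ∣ T ∣
  isOdd-∣∣-cong {S} {T} S≗T = begin
    isOdd ∣ S ∣          ≡⟨ isOdd-count S allEdges ⟩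
    ⊕ˡ (map S allEdges)  ≡⟨ cong ⊕ˡ (map-cong S≗T allEdges) ⟩
    ⊕ˡ (map T allEdges)  ≡⟨ isOdd-count T allEdges ⟨
    isOdd ∣ T ∣          ∎

  isOdd-∣∩cut∣ : (J : EdgeSet) (X : VertexSet {n₁} {n₂} {n₃}) →
    isOdd ∣ J ∩ cut X ∣ ≡ ∑ᵛ (λ v → X v ∧ deg J v)
  isOdd-∣∩cut∣ J X = begin
    isOdd ∣ J ∩ cut X ∣
      ≡⟨ isOdd-∣∣ (J ∩ cut X) ⟩
    ∑[ i < n₁ ] ∑[ j < n₂ ] (J (e₁₂ i j) ∧ (X₁ i xor X₂ j))
      xor ∑[ j < n₂ ] ∑[ k < n₃ ] (J (e₂₃ j k) ∧ (X₂ j xor X₃ k))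
      ≡⟨ cong₂ _xor_ (∑∑-∧-xor (λ i j → J (e₁₂ i j)) X₁ X₂)
                     (∑∑-∧-xor (λ j k → J (e₂₃ j k)) X₂ X₃) ⟩
    (A xor B₁) xor (B₃ xor C)
      ≡⟨ xor-assoc A B₁ (B₃ xor C) ⟩
    A xor (B₁ xor (B₃ xor C))
      ≡⟨ cong (A xor_) (sym (xor-assoc B₁ B₃ C)) ⟩
    A xor ((B₁ xor B₃) xor C)
      ≡⟨ cong (λ B → A xor (B xor C)) (∑-distrib-+ (λ j → X₂ j ∧ in₁ j) (λ j → X₂ j ∧ out₃ j)) ⟨
    A xor (∑[ j < n₂ ] ((X₂ j ∧ in₁ j) xor (X₂ j ∧ out₃ j)) xor C)
      ≡⟨ cong (λ B → A xor (B xor C)) (sum-cong-≗ (λ j → ∧-distribˡ-xor (X₂ j) (in₁ j) (out₃ j))) ⟨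
    ∑ᵛ (λ v → X v ∧ deg J v) ∎
    where
    X₁ : Fin n₁ → Bool
    X₁ = X ∘ v₁
    X₂ : Fin n₂ → Bool
    X₂ = X ∘ v₂
    X₃ : Fin n₃ → Bool
    X₃ = X ∘ v₃
    in₁ out₃ : Fin n₂ → Bool
    in₁ j = ∑[ i < n₁ ] J (e₁₂ i j)
    out₃ j = ∑[ k < n₃ ] J (e₂₃ j k)
    A B₁ B₃ C : Bool
    A = ∑[ i < n₁ ] (X₁ i ∧ deg J (v₁ i))
    B₁ = ∑[ j < n₂ ] (X₂ j ∧ in₁ j)
    B₃ = ∑[ j < n₂ ] (X₂ j ∧ out₃ j)
    C = ∑[ k < n₃ ] (X₃ k ∧ deg J (v₃ k))

  handshake : (J : EdgeSet {n₁} {n₂} {n₃}) → ∑ᵛ (deg J) ≡ false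
  handshake J = begin
    ∑ᵛ (deg J)                      ≡⟨ isOdd-∣∩cut∣ J (λ _ → true) ⟨
    isOdd ∣ J ∩ cut (λ _ → true) ∣  ≡⟨ isOdd-∣∣ (J ∩ cut (λ _ → true)) ⟩
    ∑[ i < n₁ ] ∑[ j < n₂ ] (J (e₁₂ i j) ∧ false) xor ∑[ j < n₂ ] ∑[ k < n₃ ] (J (e₂₃ j k) ∧ false)
      ≡⟨ cong₂ _xor_ (∑∑-false (λ i j → J (e₁₂ i j))) (∑∑-false (λ j k → J (e₂₃ j k))) ⟩
    false                           ∎
    where
    ∑∑-false : ∀ {m n} (F : Fin m → Fin n → Bool) → ∑[ i < m ] ∑[ j < n ] (F i j ∧ false) ≡ false
    ∑∑-false {m} {n} F =
      trans (sum-cong-≗ λ i → trans (sum-cong-≗ λ j → ∧-zeroʳ (F i j)) (∑-false n)) (∑-false m)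

  only₁ : Fin n₁ → VertexSet {n₁} {n₂} {n₃}
  only₁ i (v₁ i′) = i′ == i
  only₁ i (v₂ _) = false
  only₁ i (v₃ _) = false

  only₃ : Fin n₃ → VertexSet {n₁} {n₂} {n₃}
  only₃ k (v₁ _) = false
  only₃ k (v₂ _) = false
  only₃ k (v₃ k′) = k′ == k

  allBut₃ : Fin n₃ → VertexSet {n₁} {n₂} {n₃}
  allBut₃ k v = not (only₃ k v)

  V₁∪ : (Fin n₂ → Bool) → VertexSet {n₁} {n₂} {n₃}
  V₁∪ B (v₁ _) = true
  V₁∪ B (v₂ j) = B j
  V₁∪ B (v₃ _) = false

  only₁-crossing : ∀ i j → cut (only₁ i) (e₁₂ i j) ≡ true
  only₁-crossing i j = trans (xor-identityʳ (i == i)) (==-refl i)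

  allBut₃-crossing : ∀ j k → cut (allBut₃ k) (e₂₃ j k) ≡ true
  allBut₃-crossing j k = cong (λ b → true xor not b) (==-refl k)

  ∑ᵛ-only₁ : ∀ i (f : Vertex n₁ n₂ n₃ → Bool) → ∑ᵛ (λ v → only₁ i v ∧ f v) ≡ f (v₁ i)
  ∑ᵛ-only₁ i f = trans (cong₂ _xor_ (∑-indicator i (f ∘ v₁)) (cong₂ _xor_ (∑-false n₂) (∑-false n₃)))
                       (xor-identityʳ (f (v₁ i)))

  ∑ᵛ-allBut₃ : ∀ k (f : Vertex n₁ n₂ n₃ → Bool) →
    ∑ᵛ (λ v → allBut₃ k v ∧ f v) ≡ ∑ᵛ f xor f (v₃ k)
  ∑ᵛ-allBut₃ k f = begin
    A xor (B xor ∑[ k′ < n₃ ] (not (k′ == k) ∧ f (v₃ k′)))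
      ≡⟨ cong (λ C → A xor (B xor C)) (∑-not∧ (λ k′ → k′ == k) (f ∘ v₃)) ⟩
    A xor (B xor (∑[ k′ < n₃ ] f (v₃ k′) xor ∑[ k′ < n₃ ] ((k′ == k) ∧ f (v₃ k′))))
      ≡⟨ cong (λ d → A xor (B xor (∑[ k′ < n₃ ] f (v₃ k′) xor d))) (∑-indicator k (f ∘ v₃)) ⟩
    A xor (B xor (∑[ k′ < n₃ ] f (v₃ k′) xor f (v₃ k)))
      ≡⟨ cong (A xor_) (sym (xor-assoc B _ (f (v₃ k)))) ⟩
    A xor ((B xor ∑[ k′ < n₃ ] f (v₃ k′)) xor f (v₃ k))
      ≡⟨ sym (xor-assoc A _ (f (v₃ k))) ⟩
    ∑ᵛ f xor f (v₃ k) ∎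
    where
    A B : Bool
    A = ∑[ i < n₁ ] f (v₁ i)
    B = ∑[ j < n₂ ] f (v₂ j)

  ∑ᵛ-V₁∪ : ∀ B (f : Vertex n₁ n₂ n₃ → Bool) →
    ∑ᵛ (λ v → V₁∪ B v ∧ f v) ≡ ∑[ i < n₁ ] f (v₁ i) xor ∑[ j < n₂ ] (B j ∧ f (v₂ j))
  ∑ᵛ-V₁∪ B f = cong (∑[ i < n₁ ] f (v₁ i) xor_)
    (trans (cong (∑[ j < n₂ ] (B j ∧ f (v₂ j)) xor_) (∑-false n₃)) (xor-identityʳ _))

  record OddDegrees (J : EdgeSet {n₁} {n₂} {n₃}) : Set where
    field
      odd-at-V₁ : ∀ i → deg J (v₁ i) ≡ true
      odd-at-V₃ : ∀ k → deg J (v₃ k) ≡ true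
      odd-across-V₂ : ∀ (B : Fin n₂ → Bool) {j₀ j₁} → B j₀ ≡ true → B j₁ ≡ false →
        isOdd n₁ xor ∑[ j < n₂ ] (B j ∧ deg J (v₂ j)) ≡ true

  -- Connectivity of both shores of cut X, phrased without paths: every 2-colouring Z that is
  -- constant along the edges outside the cut is constant on each shore, x and y being representatives.
  ShoresConnected : VertexSet {n₁} {n₂} {n₃} → Vertex n₁ n₂ n₃ → Vertex n₁ n₂ n₃ → Set
  ShoresConnected X x y = ∀ (Z : VertexSet) → (∀ e → cut X e ≡ false → Z (tail e) ≡ Z (head e)) →
    ∀ v → Z v ≡ Z (if X v then x else y)

  cut-isDirectedBond : (X : VertexSet) {x y : Vertex n₁ n₂ n₃} → ShoresConnected X x y →
    NonEmpty (cut X) → (∀ e → cut X e ≡ true → X (tail e) ≡ true) → IsDirectedBond (cut X)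
  cut-isDirectedBond X {x} {y} connected nonEmpty forward =
    ((X , λ _ → refl) , nonEmpty , minimal) , X , (λ _ → refl) , forward
    where
    -- A nonempty cut Z inside cut X is constant off cut X, hence on each shore, so it separates the shores.
    minimal : ∀ T → IsCut T → NonEmpty T → T ⊆ cut X → cut X ⊆ T
    minimal T (Z , T≗cutZ) (e₁ , e₁∈T) T⊆cutX e e∈cutX = begin
      T e                              ≡⟨ T≗cutZ e ⟩
      cut Z e                          ≡⟨ crossing-colour e e∈cutX ⟩
      Z x xor Z y                      ≡⟨ crossing-colour e₁ (T⊆cutX e₁ e₁∈T) ⟨
      cut Z e₁                         ≡⟨ T≗cutZ e₁ ⟨
      T e₁                             ≡⟨ e₁∈T ⟩
      true                             ∎
      where
      constant : ∀ e → cut X e ≡ false → Z (tail e) ≡ Z (head e)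
      constant e e∉cutX with cut Z e in e∈cutZ
      ... | true = contradiction (trans (sym e∉cutX) (T⊆cutX e (trans (T≗cutZ e) e∈cutZ))) λ ()
      ... | false = xor≡false⇒≡ e∈cutZ
      crossing-colour : ∀ e → cut X e ≡ true → cut Z e ≡ Z x xor Z y
      crossing-colour e e∈cutX = begin
        Z (tail e) xor Z (head e)
          ≡⟨ cong₂ _xor_ (connected Z constant (tail e)) (connected Z constant (head e)) ⟩
        colour (X (tail e)) xor colour (X (head e))
          ≡⟨ xor≡true⇒map-xor colour e∈cutX ⟩
        Z x xor Z y ∎
        where
        colour : Bool → Bool
        colour b = Z (if b then x else y)

  only₁-cut : ∀ i i′ j → cut (only₁ i) (e₁₂ i′ j) ≡ true → i′ ≡ i
  only₁-cut i i′ _ crossing = ==⇒≡ (trans (sym (xor-identityʳ (i′ == i))) crossing)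

  allBut₃-cut : ∀ k k′ j → cut (allBut₃ k) (e₂₃ j k′) ≡ true → k′ ≡ k
  allBut₃-cut k k′ _ crossing = ==⇒≡ (not-injective (xor≡true⇒≡not crossing))

  only₁-isDirectedBond : ∀ i → Fin n₂ → Fin n₃ → IsDirectedBond (cut (only₁ i))
  only₁-isDirectedBond i j k =
    cut-isDirectedBond (only₁ i) connected (e₁₂ i j , only₁-crossing i j) forward
    where
    forward : ∀ e → cut (only₁ i) e ≡ true → only₁ i (tail e) ≡ true
    forward (e₁₂ i′ j′) crossing = trans (sym (xor-identityʳ (i′ == i))) crossing
    connected : ShoresConnected (only₁ i) (v₁ i) (v₂ j)
    connected Z constant (v₁ i′) with i′ == i in i′==i
    ... | true = cong (Z ∘ v₁) (==⇒≡ i′==i)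
    ... | false = constant (e₁₂ i′ j) (cong (_xor false) i′==i)
    connected Z constant (v₂ j′) = trans (constant (e₂₃ j′ k) refl) (sym (constant (e₂₃ j k) refl))
    connected Z constant (v₃ k′) = sym (constant (e₂₃ j k′) refl)

  allBut₃-isDirectedBond : ∀ k → Fin n₁ → Fin n₂ → IsDirectedBond (cut (allBut₃ k))
  allBut₃-isDirectedBond k i j =
    cut-isDirectedBond (allBut₃ k) connected (e₂₃ j k , allBut₃-crossing j k) forward
    where
    forward : ∀ e → cut (allBut₃ k) e ≡ true → allBut₃ k (tail e) ≡ true
    forward (e₂₃ j′ k′) _ = refl
    connected : ShoresConnected (allBut₃ k) (v₂ j) (v₃ k)
    connected Z constant (v₁ i′) = constant (e₁₂ i′ j) refl
    connected Z constant (v₂ j′) = trans (sym (constant (e₁₂ i j′) refl)) (constant (e₁₂ i j) refl)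
    connected Z constant (v₃ k′) with k′ == k in k′==k
    ... | true = cong (Z ∘ v₃) (==⇒≡ k′==k)
    ... | false = sym (constant (e₂₃ j k′) (cong (λ b → true xor not b) k′==k))

  V₁∪-isDirectedBond : ∀ (B : Fin n₂ → Bool) {j₀ j₁} → B j₀ ≡ true → B j₁ ≡ false →
    Fin n₁ → Fin n₃ → IsDirectedBond (cut (V₁∪ B))
  V₁∪-isDirectedBond B {j₀} {j₁} j₀∈B j₁∉B i k =
    cut-isDirectedBond (V₁∪ B) connected (e₂₃ j₀ k , trans (xor-identityʳ (B j₀)) j₀∈B) forward
    where
    forward : ∀ e → cut (V₁∪ B) e ≡ true → V₁∪ B (tail e) ≡ true
    forward (e₁₂ _ _) _ = refl
    forward (e₂₃ j k′) crossing = trans (sym (xor-identityʳ (B j))) crossing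
    connected : ShoresConnected (V₁∪ B) (v₁ i) (v₃ k)
    connected Z constant (v₁ i′) = trans (constant (e₁₂ i′ j₀) inside) (sym (constant (e₁₂ i j₀) inside))
      where
      inside : true xor B j₀ ≡ false
      inside = cong (true xor_) j₀∈B
    connected Z constant (v₂ j) with B j in j∈B
    ... | true = sym (constant (e₁₂ i j) (cong (true xor_) j∈B))
    ... | false = constant (e₂₃ j k) (cong (_xor false) j∈B)
    connected Z constant (v₃ k′) = trans (sym (constant (e₂₃ j₁ k′) outside)) (constant (e₂₃ j₁ k) outside)
      where
      outside : B j₁ xor false ≡ false
      outside = cong (_xor false) j₁∉B

  module DirectedShore (X : VertexSet {n₁} {n₂} {n₃})
    (forward : ∀ e → cut X e ≡ true → X (tail e) ≡ true)
    (minimal : ∀ T → IsCut T → NonEmpty T → T ⊆ cut X → cut X ⊆ T) where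

    tail∈X : ∀ e → X (head e) ≡ true → X (tail e) ≡ true
    tail∈X e head∈X with X (tail e) in tail∈X?
    ... | true = refl
    ... | false = trans (sym tail∈X?) (forward e (cong₂ _xor_ tail∈X? head∈X))

    head∉X : ∀ e → X (tail e) ≡ false → X (head e) ≡ false
    head∉X e tail∉X = ¬-not (λ head∈X → contradiction (trans (sym (tail∈X e head∈X)) tail∉X) λ ())

    cut-shrinks-to : ∀ Y → NonEmpty (cut Y) → cut Y ⊆ cut X → cut X ⊆ cut Y
    cut-shrinks-to Y = minimal (cut Y) (Y , λ _ → refl)

    without-V₂ : (∀ j → X (v₂ j) ≡ false) → NonEmpty (cut X) → ∃ λ i → X ≗ only₁ i
    without-V₂ V₂∉X (e₂₃ j k , crossing) = contradiction (trans (sym (forward _ crossing)) (V₂∉X j)) λ ()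
    without-V₂ V₂∉X (e₁₂ i j , crossing) = i , X≗only₁
      where
      i∈X : X (v₁ i) ≡ true
      i∈X = forward _ crossing
      X⊆only₁ : cut X ⊆ cut (only₁ i)
      X⊆only₁ = cut-shrinks-to (only₁ i) (e₁₂ i j , only₁-crossing i j) λ where
        (e₁₂ i′ j′) crossing′ →
          cong₂ _xor_ (trans (cong (X ∘ v₁) (only₁-cut i i′ j′ crossing′)) i∈X) (V₂∉X j′)
      X≗only₁ : X ≗ only₁ i
      X≗only₁ (v₁ i′) with i′ ≟ i
      ... | yes refl = i∈X
      ... | no i′≢i = ¬-not λ i′∈X →
        i′≢i (only₁-cut i i′ j (X⊆only₁ (e₁₂ i′ j) (cong₂ _xor_ i′∈X (V₂∉X j))))
      X≗only₁ (v₂ j′) = V₂∉X j′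
      X≗only₁ (v₃ k) = head∉X (e₂₃ j k) (V₂∉X j)

    within-V₂ : (∀ j → X (v₂ j) ≡ true) → NonEmpty (cut X) → ∃ λ k → X ≗ allBut₃ k
    within-V₂ V₂⊆X (e₁₂ i j , crossing) =
      contradiction (trans (sym crossing) (cong₂ _xor_ (forward _ crossing) (V₂⊆X j))) λ ()
    within-V₂ V₂⊆X (e₂₃ j k , crossing) = k , X≗allBut₃
      where
      k∉X : X (v₃ k) ≡ false
      k∉X = trans (xor≡true⇒≡not crossing) (cong not (V₂⊆X j))
      X⊆allBut₃ : cut X ⊆ cut (allBut₃ k)
      X⊆allBut₃ = cut-shrinks-to (allBut₃ k) (e₂₃ j k , allBut₃-crossing j k) λ where
        (e₂₃ j′ k′) crossing′ →
          cong₂ _xor_ (V₂⊆X j′) (trans (cong (X ∘ v₃) (allBut₃-cut k k′ j′ crossing′)) k∉X)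
      X≗allBut₃ : X ≗ allBut₃ k
      X≗allBut₃ (v₁ i) = tail∈X (e₁₂ i j) (V₂⊆X j)
      X≗allBut₃ (v₂ j′) = V₂⊆X j′
      X≗allBut₃ (v₃ k′) with k′ ≟ k
      ... | yes refl = k∉X
      ... | no k′≢k = ¬-not λ k′∉X →
        k′≢k (allBut₃-cut k k′ j (X⊆allBut₃ (e₂₃ j k′) (cong₂ _xor_ (V₂⊆X j) k′∉X)))

    straddling-V₂ : ∀ {j₀ j₁} → X (v₂ j₀) ≡ true → X (v₂ j₁) ≡ false → X ≗ V₁∪ (X ∘ v₂)
    straddling-V₂ {j₀} j₀∈X j₁∉X (v₁ i) = tail∈X (e₁₂ i j₀) j₀∈X
    straddling-V₂ j₀∈X j₁∉X (v₂ j) = refl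
    straddling-V₂ {j₁ = j₁} j₀∈X j₁∉X (v₃ k) = head∉X (e₂₃ j₁ k) j₁∉X

    classification : NonEmpty (cut X) →
      (∃ λ i → X ≗ only₁ i) ⊎ (∃ λ k → X ≗ allBut₃ k)
        ⊎ ∃ λ j₀ → ∃ λ j₁ → X (v₂ j₀) ≡ true × X (v₂ j₁) ≡ false
    classification nonEmpty with any? (λ j → X (v₂ j) Bool.≟ true) | any? (λ j → X (v₂ j) Bool.≟ false)
    ... | no none-in | _ = inj₁ (without-V₂ (λ j → ¬-not (λ j∈X → none-in (j , j∈X))) nonEmpty)
    ... | yes _ | no none-out =
      inj₂ (inj₁ (within-V₂ (λ j → ¬-not (λ j∉X → none-out (j , j∉X))) nonEmpty))
    ... | yes (j₀ , j₀∈X) | yes (j₁ , j₁∉X) = inj₂ (inj₂ (j₀ , j₁ , j₀∈X , j₁∉X))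

    module _ {J : EdgeSet} (degrees : OddDegrees J) where
      open OddDegrees degrees

      odd-shore : NonEmpty (cut X) → ∑ᵛ (λ v → X v ∧ deg J v) ≡ true
      odd-shore nonEmpty with classification nonEmpty
      ... | inj₁ (i , X≗only₁) = begin
        ∑ᵛ (λ v → X v ∧ deg J v)              ≡⟨ ∑ᵛ-cong-shore (deg J) X≗only₁ ⟩
        ∑ᵛ (λ v → only₁ i v ∧ deg J v)        ≡⟨ ∑ᵛ-only₁ i (deg J) ⟩
        deg J (v₁ i)                           ≡⟨ odd-at-V₁ i ⟩
        true                                   ∎
      ... | inj₂ (inj₁ (k , X≗allBut₃)) = begin
        ∑ᵛ (λ v → X v ∧ deg J v)              ≡⟨ ∑ᵛ-cong-shore (deg J) X≗allBut₃ ⟩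
        ∑ᵛ (λ v → allBut₃ k v ∧ deg J v)      ≡⟨ ∑ᵛ-allBut₃ k (deg J) ⟩
        ∑ᵛ (deg J) xor deg J (v₃ k)            ≡⟨ cong (_xor deg J (v₃ k)) (handshake J) ⟩
        deg J (v₃ k)                           ≡⟨ odd-at-V₃ k ⟩
        true                                   ∎
      ... | inj₂ (inj₂ (j₀ , j₁ , j₀∈X , j₁∉X)) = begin
        ∑ᵛ (λ v → X v ∧ deg J v)              ≡⟨ ∑ᵛ-cong-shore (deg J) (straddling-V₂ j₀∈X j₁∉X) ⟩
        ∑ᵛ (λ v → V₁∪ (X ∘ v₂) v ∧ deg J v)   ≡⟨ ∑ᵛ-V₁∪ (X ∘ v₂) (deg J) ⟩
        ∑[ i < n₁ ] deg J (v₁ i) xor ∑[ j < n₂ ] (X (v₂ j) ∧ deg J (v₂ j))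
          ≡⟨ cong (_xor ∑[ j < n₂ ] (X (v₂ j) ∧ deg J (v₂ j))) (∑-all-true odd-at-V₁) ⟩
        isOdd n₁ xor ∑[ j < n₂ ] (X (v₂ j) ∧ deg J (v₂ j))
          ≡⟨ odd-across-V₂ (X ∘ v₂) j₀∈X j₁∉X ⟩
        true                                   ∎

isOddDijoin⇒oddDegrees : ∀ {a b c} (J : EdgeSet {suc a} {suc b} {suc c}) → IsOddDijoin J → OddDegrees J
isOddDijoin⇒oddDegrees {a} {b} {c} J odd = record
  { odd-at-V₁ = odd-at-V₁ ; odd-at-V₃ = odd-at-V₃ ; odd-across-V₂ = odd-across-V₂ }
  where
  odd-shore : ∀ X → IsDirectedBond (cut X) → ∑ᵛ (λ v → X v ∧ deg J v) ≡ true
  odd-shore X bond = trans (sym (isOdd-∣∩cut∣ J X)) (%2≡1⇒isOdd ∣ J ∩ cut X ∣ (odd (cut X) bond))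
  odd-at-V₁ : ∀ i → deg J (v₁ i) ≡ true
  odd-at-V₁ i = trans (sym (∑ᵛ-only₁ i (deg J))) (odd-shore (only₁ i) (only₁-isDirectedBond i zero zero))
  odd-at-V₃ : ∀ k → deg J (v₃ k) ≡ true
  odd-at-V₃ k = begin
    deg J (v₃ k)                          ≡⟨ cong (_xor deg J (v₃ k)) (handshake J) ⟨
    ∑ᵛ (deg J) xor deg J (v₃ k)           ≡⟨ ∑ᵛ-allBut₃ k (deg J) ⟨
    ∑ᵛ (λ v → allBut₃ k v ∧ deg J v)     ≡⟨ odd-shore (allBut₃ k) (allBut₃-isDirectedBond k zero zero) ⟩
    true                                  ∎
  odd-across-V₂ : ∀ (B : Fin (suc b) → Bool) {j₀ j₁} → B j₀ ≡ true → B j₁ ≡ false →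
    isOdd (suc a) xor ∑[ j < suc b ] (B j ∧ deg J (v₂ j)) ≡ true
  odd-across-V₂ B j₀∈B j₁∉B = begin
    isOdd (suc a) xor ∑[ j < suc b ] (B j ∧ deg J (v₂ j))
      ≡⟨ cong (_xor ∑[ j < suc b ] (B j ∧ deg J (v₂ j))) (∑-all-true odd-at-V₁) ⟨
    ∑[ i < suc a ] deg J (v₁ i) xor ∑[ j < suc b ] (B j ∧ deg J (v₂ j))
      ≡⟨ ∑ᵛ-V₁∪ B (deg J) ⟨
    ∑ᵛ (λ v → V₁∪ B v ∧ deg J v)
      ≡⟨ odd-shore (V₁∪ B) (V₁∪-isDirectedBond B j₀∈B j₁∉B zero zero) ⟩
    true ∎

oddDegrees⇒isOddDijoin : ∀ {n₁ n₂ n₃} {J : EdgeSet {n₁} {n₂} {n₃}} → OddDegrees J → IsOddDijoin J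
oddDegrees⇒isOddDijoin {J = J} degrees S ((_ , (e , e∈S) , minimal) , X , S≗cutX , forward) =
  isOdd⇒%2≡1 ∣ J ∩ S ∣ (begin
    isOdd ∣ J ∩ S ∣             ≡⟨ isOdd-∣∣-cong (λ e → cong (J e ∧_) (S≗cutX e)) ⟩
    isOdd ∣ J ∩ cut X ∣         ≡⟨ isOdd-∣∩cut∣ J X ⟩
    ∑ᵛ (λ v → X v ∧ deg J v)    ≡⟨ odd-shore degrees (e , S⊆cutX e e∈S) ⟩
    true                        ∎)
  where
  S⊆cutX : S ⊆ cut X
  S⊆cutX e = trans (sym (S≗cutX e))
  cutX⊆S : cut X ⊆ S
  cutX⊆S e = trans (S≗cutX e)
  open DirectedShore X (λ e → forward e ∘ cutX⊆S e)
    (λ T isCut nonEmpty T⊆cutX e →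
       minimal T isCut nonEmpty (λ e′ → cutX⊆S e′ ∘ T⊆cutX e′) e ∘ cutX⊆S e)

module _ {a m c : ℕ} {J : EdgeSet {suc a} {suc (suc m)} {suc c}} (degrees : OddDegrees J) where
  open OddDegrees degrees

  deg-V₂-forced : ∀ j → deg J (v₂ j) ≡ not (isOdd (suc a))
  deg-V₂-forced j = xor≡true⇒≡not (begin
    isOdd (suc a) xor deg J (v₂ j)
      ≡⟨ cong (isOdd (suc a) xor_) (∑-indicator j (deg J ∘ v₂)) ⟨
    isOdd (suc a) xor ∑[ k < suc (suc m) ] ((k == j) ∧ deg J (v₂ k))
      ≡⟨ odd-across-V₂ (_== j) {j} {punchIn j zero} (==-refl j) other≠j ⟩
    true ∎)
    where
    other≠j : (punchIn j zero == j) ≡ false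
    other≠j = dec-false (punchIn j zero ≟ j) (punchInᵢ≢i j zero)

  handshake-parity : isOdd (suc a) xor ((isOdd (suc (suc m)) ∧ not (isOdd (suc a))) xor isOdd (suc c)) ≡ false
  handshake-parity = begin
    isOdd (suc a) xor ((isOdd (suc (suc m)) ∧ not (isOdd (suc a))) xor isOdd (suc c))
      ≡⟨ cong₂ _xor_ (∑-all-true odd-at-V₁) (cong₂ _xor_ ∑-deg-V₂ (∑-all-true odd-at-V₃)) ⟨
    ∑ᵛ (deg J)
      ≡⟨ handshake J ⟩
    false ∎
    where
    ∑-deg-V₂ : ∑[ j < suc (suc m) ] deg J (v₂ j) ≡ isOdd (suc (suc m)) ∧ not (isOdd (suc a))
    ∑-deg-V₂ = trans (sum-cong-≗ deg-V₂-forced) (∑-const (suc (suc m)) (not (isOdd (suc a))))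

two-middle-vertices : ∀ {a c} {J : EdgeSet {suc a} {2} {suc c}} → OddDegrees J → isOdd (suc a) ≡ isOdd (suc c)
two-middle-vertices degrees = xor≡false⇒≡ (handshake-parity degrees)

many-middle-vertices : ∀ {a m c} {J : EdgeSet {suc a} {suc (suc (suc m))} {suc c}} → OddDegrees J →
  isOdd (suc a) ≡ true × isOdd (suc c) ≡ true
many-middle-vertices {a} {m} {c} {J} degrees = n₁-odd , n₃-odd
  where
  open OddDegrees degrees
  first-two : Fin (suc (suc (suc m))) → Bool
  first-two zero = true
  first-two (suc zero) = true
  first-two (suc (suc _)) = false
  d₀ d₁ : Bool
  d₀ = deg J (v₂ zero)
  d₁ = deg J (v₂ (suc zero))
  first-two-sum : ∑[ j < suc (suc (suc m)) ] (first-two j ∧ deg J (v₂ j)) ≡ false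
  first-two-sum = begin
    d₀ xor (d₁ xor ∑[ j < suc m ] false)     ≡⟨ cong (λ z → d₀ xor (d₁ xor z)) (∑-false (suc m)) ⟩
    d₀ xor (d₁ xor false)                    ≡⟨ cong (d₀ xor_) (xor-identityʳ d₁) ⟩
    d₀ xor d₁
      ≡⟨ cong₂ _xor_ (deg-V₂-forced degrees zero) (deg-V₂-forced degrees (suc zero)) ⟩
    not (isOdd (suc a)) xor not (isOdd (suc a)) ≡⟨ xor-same (not (isOdd (suc a))) ⟩
    false                                    ∎
  n₁-odd : isOdd (suc a) ≡ true
  n₁-odd = begin
    isOdd (suc a)                            ≡⟨ xor-identityʳ (isOdd (suc a)) ⟨
    isOdd (suc a) xor false                  ≡⟨ cong (isOdd (suc a) xor_) first-two-sum ⟨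
    isOdd (suc a) xor ∑[ j < suc (suc (suc m)) ] (first-two j ∧ deg J (v₂ j))
                                             ≡⟨ odd-across-V₂ first-two {zero} {suc (suc zero)} refl refl ⟩
    true                                     ∎
  n₃-odd : isOdd (suc c) ≡ true
  n₃-odd = sym (xor≡false⇒≡ (begin
    true xor isOdd (suc c)
      ≡⟨ cong (λ x → true xor (x xor isOdd (suc c))) (∧-zeroʳ p₂) ⟨
    true xor ((p₂ ∧ false) xor isOdd (suc c))
      ≡⟨ cong (λ p → p xor ((p₂ ∧ not p) xor isOdd (suc c))) n₁-odd ⟨
    isOdd (suc a) xor ((p₂ ∧ not (isOdd (suc a))) xor isOdd (suc c))
      ≡⟨ handshake-parity degrees ⟩
    false ∎))
    where
    p₂ : Bool
    p₂ = isOdd (suc (suc (suc m)))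

module _ {n₁ n₂ n₃ : ℕ} where

  star : Fin n₂ → EdgeSet {n₁} {n₂} {n₃}
  star hub (e₁₂ _ j) = j == hub
  star hub (e₂₃ j _) = j == hub

  star-deg-V₂ : isOdd n₁ ≡ true → isOdd n₃ ≡ true → ∀ hub j → deg (star hub) (v₂ j) ≡ false
  star-deg-V₂ n₁-odd n₃-odd hub j = begin
    ∑[ i < n₁ ] (j == hub) xor ∑[ k < n₃ ] (j == hub)
      ≡⟨ cong₂ _xor_ (∑-const n₁ (j == hub)) (∑-const n₃ (j == hub)) ⟩
    (isOdd n₁ ∧ (j == hub)) xor (isOdd n₃ ∧ (j == hub))
      ≡⟨ cong₂ (λ p q → (p ∧ (j == hub)) xor (q ∧ (j == hub))) n₁-odd n₃-odd ⟩
    (j == hub) xor (j == hub)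
      ≡⟨ xor-same (j == hub) ⟩
    false ∎

  star-oddDegrees : ∀ hub →
    (∀ (B : Fin n₂ → Bool) {j₀ j₁} → B j₀ ≡ true → B j₁ ≡ false →
       isOdd n₁ xor ∑[ j < n₂ ] (B j ∧ deg (star hub) (v₂ j)) ≡ true) →
    OddDegrees (star hub)
  star-oddDegrees hub odd-across-V₂ = record
    { odd-at-V₁ = λ _ → ∑-singleton hub
    ; odd-at-V₃ = λ _ → ∑-singleton hub
    ; odd-across-V₂ = odd-across-V₂
    }

  star-oddDegrees-odd : isOdd n₁ ≡ true → isOdd n₃ ≡ true → ∀ hub → OddDegrees (star hub)
  star-oddDegrees-odd n₁-odd n₃-odd hub = star-oddDegrees hub λ B _ _ → begin
    isOdd n₁ xor ∑[ j < n₂ ] (B j ∧ deg (star hub) (v₂ j))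
      ≡⟨ cong (isOdd n₁ xor_) (sum-cong-≗ λ j →
           trans (cong (B j ∧_) (star-deg-V₂ n₁-odd n₃-odd hub j)) (∧-zeroʳ (B j))) ⟩
    isOdd n₁ xor ∑[ j < n₂ ] false
      ≡⟨ cong (isOdd n₁ xor_) (∑-false n₂) ⟩
    isOdd n₁ xor false
      ≡⟨ xor-identityʳ (isOdd n₁) ⟩
    isOdd n₁
      ≡⟨ n₁-odd ⟩
    true ∎

star-oddDegrees-single : ∀ {n₁ n₃} → OddDegrees (star {n₁} {1} {n₃} zero)
star-oddDegrees-single = star-oddDegrees zero λ where
  B {zero} {zero} zero∈B zero∉B → contradiction (trans (sym zero∈B) zero∉B) λ ()

-- The star at v₂ 0 with the edge from v₁ 0 moved to v₂ 1.
twisted-star : ∀ {n₁ n₃} → EdgeSet {suc n₁} {2} {n₃}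
twisted-star (e₁₂ i j) = (i == zero) xor (j == zero)
twisted-star (e₂₃ j _) = j == zero

twisted-star-oddDegrees : ∀ {a c} → isOdd (suc a) ≡ false → isOdd (suc c) ≡ false →
  OddDegrees (twisted-star {a} {suc c})
twisted-star-oddDegrees {a} {c} n₁-even n₃-even = record
  { odd-at-V₁ = λ { zero → refl ; (suc _) → refl }
  ; odd-at-V₃ = λ _ → refl
  ; odd-across-V₂ = odd-across-V₂
  }
  where
  T : EdgeSet {suc a} {2} {suc c}
  T = twisted-star
  twisted-deg-V₂ : ∀ j → deg T (v₂ j) ≡ true
  twisted-deg-V₂ zero = cong₂ _xor_ (trans (∑-true a) (not-injective n₁-even)) (trans (∑-true (suc c)) n₃-even)
  twisted-deg-V₂ (suc zero) = cong₂ (λ x y → (true xor x) xor y) (∑-false a) (∑-false (suc c))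
  odd-across-V₂ : ∀ (B : Fin 2 → Bool) {j₀ j₁} → B j₀ ≡ true → B j₁ ≡ false →
    isOdd (suc a) xor ∑[ j < 2 ] (B j ∧ deg T (v₂ j)) ≡ true
  odd-across-V₂ B {j₀} {j₁} j₀∈B j₁∉B = begin
    isOdd (suc a) xor ∑[ j < 2 ] (B j ∧ deg T (v₂ j))
      ≡⟨ cong₂ _xor_ n₁-even (sum-cong-≗ λ j → trans (cong (B j ∧_) (twisted-deg-V₂ j)) (∧-identityʳ (B j))) ⟩
    B zero xor (B (suc zero) xor false)
      ≡⟨ cong (B zero xor_) (xor-identityʳ (B (suc zero))) ⟩
    B zero xor B (suc zero)
      ≡⟨ proper j₀ j₁ j₀∈B j₁∉B ⟩
    true ∎
    where
    proper : ∀ j₀ j₁ → B j₀ ≡ true → B j₁ ≡ false → B zero xor B (suc zero) ≡ true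
    proper zero (suc zero) zero∈B one∉B = cong₂ _xor_ zero∈B one∉B
    proper (suc zero) zero one∈B zero∉B = cong₂ _xor_ zero∉B one∈B
    proper zero zero zero∈B zero∉B = contradiction (trans (sym zero∈B) zero∉B) λ ()
    proper (suc zero) (suc zero) one∈B one∉B = contradiction (trans (sym one∈B) one∉B) λ ()

hasOddDijoin : ∀ {n₁ n₂ n₃} {J : EdgeSet {n₁} {n₂} {n₃}} → OddDegrees J → HasOddDijoin n₁ n₂ n₃
hasOddDijoin {J = J} degrees = J , oddDegrees⇒isOddDijoin degrees

ParityCondition : ℕ → ℕ → ℕ → Set
ParityCondition n₁ n₂ n₃ =
  n₂ ≡ 1 ⊎ (n₂ ≡ 2 × n₁ % 2 ≡ n₃ % 2) ⊎ (3 ≤ n₂ × n₁ % 2 ≡ 1 × n₃ % 2 ≡ 1)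

oddDijoin⇒parityCondition : ∀ a b c → HasOddDijoin (suc a) (suc b) (suc c) → ParityCondition (suc a) (suc b) (suc c)
oddDijoin⇒parityCondition a zero c _ = inj₁ refl
oddDijoin⇒parityCondition a (suc zero) c (J , odd) =
  inj₂ (inj₁ (refl , isOdd≡⇒%2≡ (suc a) (suc c) (two-middle-vertices (isOddDijoin⇒oddDegrees J odd))))
oddDijoin⇒parityCondition a (suc (suc m)) c (J , odd) =
  let n₁-odd , n₃-odd = many-middle-vertices (isOddDijoin⇒oddDegrees J odd)
  in inj₂ (inj₂ (s≤s (s≤s (s≤s z≤n)) , isOdd⇒%2≡1 (suc a) n₁-odd , isOdd⇒%2≡1 (suc c) n₃-odd))

parityCondition⇒oddDijoin : ∀ a b c → ParityCondition (suc a) (suc b) (suc c) → HasOddDijoin (suc a) (suc b) (suc c)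
parityCondition⇒oddDijoin a b c (inj₁ refl) = hasOddDijoin star-oddDegrees-single
parityCondition⇒oddDijoin a b c (inj₂ (inj₂ (_ , n₁-odd , n₃-odd))) =
  hasOddDijoin (star-oddDegrees-odd (%2≡1⇒isOdd (suc a) n₁-odd) (%2≡1⇒isOdd (suc c) n₃-odd) zero)
parityCondition⇒oddDijoin a b c (inj₂ (inj₁ (refl , n₁≡n₃)))
  with isOdd (suc a) in n₁-parity | %2≡⇒isOdd≡ (suc a) (suc c) n₁≡n₃
... | true | n₃-odd = hasOddDijoin (star-oddDegrees-odd n₁-parity (sym n₃-odd) zero)
... | false | n₃-even = hasOddDijoin (twisted-star-oddDegrees n₁-parity (sym n₃-even))

proposition4p15 : (n₁ n₂ n₃ : ℕ) → 1 ≤ n₁ → 1 ≤ n₂ → 1 ≤ n₃ →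
    HasOddDijoin n₁ n₂ n₃ ⇔
      (n₂ ≡ 1
       ⊎ (n₂ ≡ 2 × n₁ % 2 ≡ n₃ % 2)
       ⊎ (3 ≤ n₂ × n₁ % 2 ≡ 1 × n₃ % 2 ≡ 1))
proposition4p15 (suc a) (suc b) (suc c) (s≤s z≤n) (s≤s z≤n) (s≤s z≤n) =
  mk⇔ (oddDijoin⇒parityCondition a b c) (parityCondition⇒oddDijoin a b c)
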